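{- For every $n\ge1$, the map $\phi_n:Y_n\to Q_n$ is a morphism of posets: if $t\le w$ in $Y_n$, then $\phi_n(t)\le\phi_n(w)$ componentwise in $Q_n$.
   Context: $Y_n$: planar binary rooted trees with $n$ internal vertices, with $n+1$ leaves numbered $1,\dots,n+1$ from left to right; a leaf is right oriented if it is the right child of its parent vertex, left oriented if it is the left child. Grafting $u\vee v$: join roots of $u$ (left) and $v$ (right) to a new vertex and add a new root. Weak order on $Y_n$: generated reflexively and transitively by (a) $u\le u'$, $v\le v'$ imply $u\vee v\le u'\vee v'$; (b) $(u\vee v)\vee w\le u\vee(v\vee w)$. $Q_n=\{+1,-1\}^{n-1}$, ordered by $\epsilon\le\eta$ iff $\epsilon_i\le\eta_i$ for all $i$ (with $-1<+1$). $\phi_n(t)=(\epsilon_1,\dots,\epsilon_{n-1})$ with $\epsilon_i=-1$ if leaf $i+1$ of $t$ is right oriented and $+1$ if left oriented. -}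

module Defs where

open import Data.Nat using (ℕ; zero; suc; _+_)
open import Data.List using (List; []; _∷_; _++_; drop)

-- Planar binary rooted trees (untyped); Y_n = trees with size n.
data Tree : Set where
  leaf : Tree
  _∨_  : Tree → Tree → Tree

infixr 5 _∨_

size : Tree → ℕ
size leaf    = zero
size (u ∨ v) = suc (size u + size v)

data _≤T_ : Tree → Tree → Set where
  ≤T-refl  : ∀ {t} → t ≤T t
  ≤T-trans : ∀ {t s r} → t ≤T s → s ≤T r → t ≤T r
  ≤T-graft : ∀ {u u′ v v′} → u ≤T u′ → v ≤T v′ → (u ∨ v) ≤T (u′ ∨ v′)
  ≤T-assoc : ∀ {u v w} → ((u ∨ v) ∨ w) ≤T (u ∨ (v ∨ w))

data Sign : Set where
  -1s +1s : Sign

data _≤S_ : Sign → Sign → Set where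
  -≤- : -1s ≤S -1s
  -≤+ : -1s ≤S +1s
  +≤+ : +1s ≤S +1s

-- Orientation of the leaves (left to right) of a subtree which is the
-- left child (orientsL) resp. right child (orientsR) of its parent.
mutual
  orientsL : Tree → List Sign
  orientsL leaf    = +1s ∷ []
  orientsL (u ∨ v) = orientsL u ++ orientsR v

  orientsR : Tree → List Sign
  orientsR leaf    = -1s ∷ []
  orientsR (u ∨ v) = orientsL u ++ orientsR v

dropLast : {A : Set} → List A → List A
dropLast []           = []
dropLast (x ∷ [])     = []
dropLast (x ∷ y ∷ xs) = x ∷ dropLast (y ∷ xs)

leafOrients : Tree → List Sign
leafOrients leaf    = []
leafOrients (u ∨ v) = orientsL u ++ orientsR v

-- φ_n(t) = (ε_1,…,ε_{n-1}), ε_i the orientation of leaf i+1 (leaves 2,…,n)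
φ : Tree → List Sign
φ t = dropLast (drop 1 (leafOrients t))

{-# OPTIONS --safe #-}
module Submission where

-- Grafting concatenates the orientation vectors of the two subtrees, so only
-- the rotation (u ∨ v) ∨ w ≤ u ∨ (v ∨ w) needs an argument.  There the subtree
-- v turns from a right child into a left child; this changes an orientation
-- only if v is a single leaf, which then goes from -1 to +1.

open import Defs
open import Data.Nat using (ℕ; suc; _≤_)
open import Data.List using (List; []; _∷_; _++_; drop)
open import Data.List.Properties using (++-assoc)
open import Data.List.Relation.Binary.Pointwise as Pointwise
  using (Pointwise; []; _∷_; ++⁺)
open import Relation.Binary.PropositionalEquality using (_≡_; refl; sym; subst)
open import Relation.Binary.Definitions using (Reflexive; Transitive)

≤S-refl : Reflexive _≤S_
≤S-refl { -1s} = -≤-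
≤S-refl {+1s}  = +≤+

≤S-trans : Transitive _≤S_
≤S-trans -≤- q   = q
≤S-trans -≤+ +≤+ = -≤+
≤S-trans +≤+ q   = q

private
  _≤⃗_ : List Sign → List Sign → Set
  _≤⃗_ = Pointwise _≤S_

  ≤⃗-refl : Reflexive _≤⃗_
  ≤⃗-refl = Pointwise.refl ≤S-refl

  ≤⃗-trans : Transitive _≤⃗_
  ≤⃗-trans = Pointwise.transitive ≤S-trans

module _ {ℓ} {A B : Set} {R : A → B → Set ℓ} where

  drop⁺ : ∀ k {xs ys} → Pointwise R xs ys → Pointwise R (drop k xs) (drop k ys)
  drop⁺ 0       rs       = rs
  drop⁺ (suc k) []       = []
  drop⁺ (suc k) (r ∷ rs) = drop⁺ k rs

  dropLast⁺ : ∀ {xs ys} → Pointwise R xs ys → Pointwise R (dropLast xs) (dropLast ys)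
  dropLast⁺ []           = []
  dropLast⁺ (r ∷ [])     = []
  dropLast⁺ (r ∷ s ∷ rs) = r ∷ dropLast⁺ (s ∷ rs)

orientsR≤orientsL : ∀ t → orientsR t ≤⃗ orientsL t
orientsR≤orientsL leaf    = -≤+ ∷ []
orientsR≤orientsL (_ ∨ _) = ≤⃗-refl

orientsL-rotate : ∀ u v w → orientsL ((u ∨ v) ∨ w) ≤⃗ orientsL (u ∨ (v ∨ w))
orientsL-rotate u v w =
  subst (_≤⃗ (orientsL u ++ orientsL v ++ orientsR w))
        (sym (++-assoc (orientsL u) (orientsR v) (orientsR w)))
        (++⁺ (≤⃗-refl {orientsL u}) (++⁺ (orientsR≤orientsL v) ≤⃗-refl))

-- On a graft u ∨ v, orientsL and orientsR agree definitionally, which is what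
-- lets orientsR-mono defer to orientsL-mono on the same derivation.
mutual
  orientsL-mono : ∀ {t w} → t ≤T w → orientsL t ≤⃗ orientsL w
  orientsL-mono ≤T-refl                = ≤⃗-refl
  orientsL-mono (≤T-trans p q)         = ≤⃗-trans (orientsL-mono p) (orientsL-mono q)
  orientsL-mono (≤T-graft p q)         = ++⁺ (orientsL-mono p) (orientsR-mono q)
  orientsL-mono (≤T-assoc {u} {v} {w}) = orientsL-rotate u v w

  orientsR-mono : ∀ {t w} → t ≤T w → orientsR t ≤⃗ orientsR w
  orientsR-mono ≤T-refl          = ≤⃗-refl
  orientsR-mono (≤T-trans p q)   = ≤⃗-trans (orientsR-mono p) (orientsR-mono q)
  orientsR-mono p@(≤T-graft _ _) = orientsL-mono p
  orientsR-mono p@≤T-assoc       = orientsL-mono p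

-- leafOrients agrees with orientsL except on a leaf, which 1 ≤ n rules out.
corollary3p8 : (n : ℕ) → 1 ≤ n → (t w : Tree) → size t ≡ n → size w ≡ n →
    t ≤T w → Pointwise _≤S_ (φ t) (φ w)
corollary3p8 .0 () leaf    _       refl _    _
corollary3p8 .0 () (_ ∨ _) leaf    _    refl _
corollary3p8 _  _  (_ ∨ _) (_ ∨ _) _    _    t≤w = dropLast⁺ (drop⁺ 1 (orientsL-mono t≤w))
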